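{- Let $P$ and $Q$ be $(d-1)$-dimensional simplicial posets and let $I\subset P$, $J\subset Q$ be order ideals with $I\cong J$ (via a given isomorphism). If $I\cong\Delta_d(k)$ for some $1\le k\le d$, then $$h(P\cup_I Q)=h(P)+h(Q)-\mathbf e_0+\mathbf e_k.$$
   Context: A simplicial poset is a finite poset with minimum $\hat 0$ whose lower intervals $[\hat0,\sigma]$ are Boolean algebras; rank and dimension are as usual. For a $(d-1)$-dimensional simplicial poset, $f_i$ is the number of elements of rank $i+1$ and $h=(h_0,\dots,h_d)$ is defined by $\sum_{i=0}^d f_{i-1}(1-t)^{d-i}=\sum_{i=0}^d h_it^{d-i}$. Given an isomorphism $f:I\to J$ of order ideals, $P\cup_I Q=(P\cup Q)/\!\sim$ with $\sigma\sim f(\sigma)$ for $\sigma\in I$. $\Delta_d(k)=\{F\subset[d]:F\not\supset[k]\}$ ordered by inclusion, where $[k]=\{1,\dots,k\}$. $\mathbf e_0,\dots,\mathbf e_d$ are the unit vectors of $\mathbb Z^{d+1}$ ($\mathbf e_i$ has $1$ in position $i+1$). -}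

module Defs where

open import Data.Bool using (Bool; true; false; T; not; if_then_else_)
open import Data.Nat using (ℕ; zero; suc; _∸_; _≡ᵇ_; _<ᵇ_; _≤_)
open import Data.Nat.Combinatorics using (_C_)
open import Data.Integer as ℤ using (ℤ; +_)
open import Data.Fin using (Fin; toℕ)
open import Data.Fin.Subset using (Subset; _⊆_; inside; outside)
open import Data.Fin.Subset.Properties using (_⊆?_)
open import Data.List using (List; map; foldr; upTo; allFin)
open import Data.Vec using (Vec; tabulate; zipWith)
open import Data.Product using (Σ; ∃; _×_; _,_; proj₁; proj₂)
open import Data.Sum using (_⊎_)
open import Function.Bundles using (_↔_; _⇔_; Inverse)
open import Relation.Binary.PropositionalEquality using (_≡_)
open import Relation.Binary.Structures using (IsPartialOrder)
open import Relation.Nullary.Decidable using (⌊_⌋)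

OrderIso : {A B : Set} → (A → A → Set) → (B → B → Set) → Set
OrderIso {A} {B} _≤₁_ _≤₂_ =
  Σ (A ↔ B) λ φ → ∀ x y → (x ≤₁ y) ⇔ (Inverse.to φ x ≤₂ Inverse.to φ y)

-- The carrier is a finite type (given with an enumeration by Fin size);
-- the order is Bool-valued so that subtypes are proof irrelevant.
-- rank σ together with the order isomorphism [0̂,σ] ≅ (Subset (rank σ), ⊆)
-- expresses that every lower interval is a Boolean algebra; the rank of σ
-- is the rank of that Boolean algebra.

record SimplicialPoset : Set₁ where
  field
    Carrier : Set
    size    : ℕ
    enum    : Fin size ↔ Carrier
    le      : Carrier → Carrier → Bool
    isPartialOrder : IsPartialOrder _≡_ (λ x y → T (le x y))
    bot     : Carrier
    bot-min : ∀ x → T (le bot x)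
    rank    : Carrier → ℕ
    boolean : ∀ σ → OrderIso {Σ Carrier (λ τ → T (le τ σ))} {Subset (rank σ)}
                      (λ a b → T (le (proj₁ a) (proj₁ b))) _⊆_

open SimplicialPoset public

-- P is (d-1)-dimensional: maximal rank is exactly d.
IsDim : SimplicialPoset → ℕ → Set
IsDim P d = (∀ σ → rank P σ ≤ d) × (∃ λ σ → rank P σ ≡ d)

-- number of elements of rank i, i.e. f_{i-1}
fRank : SimplicialPoset → ℕ → ℕ
fRank P i = foldr Data.Nat._+_ 0
  (map (λ j → if rank P (Inverse.to (enum P) j) ≡ᵇ i then 1 else 0) (allFin (size P)))

sgn : ℕ → ℤ
sgn zero    = + 1
sgn (suc n) = ℤ.- sgn n

sumℤ : List ℤ → ℤ
sumℤ = foldr ℤ._+_ (+ 0)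

hEntry : ℕ → SimplicialPoset → ℕ → ℤ
hEntry d P j = sumℤ (map (λ i → sgn (j ∸ i) ℤ.* (+ (((d ∸ i) C (j ∸ i)) Data.Nat.* fRank P i)))
                         (upTo (suc j)))

hVec : (d : ℕ) → SimplicialPoset → Vec ℤ (suc d)
hVec d P = tabulate (λ j → hEntry d P (toℕ j))

-- unit vector e_k in ℤ^{d+1} (1 in position k+1, i.e. index k)
unitVec : (d k : ℕ) → Vec ℤ (suc d)
unitVec d k = tabulate (λ j → if toℕ j ≡ᵇ k then + 1 else + 0)

infixl 6 _+ᵥ_ _-ᵥ_
_+ᵥ_ _-ᵥ_ : ∀ {n} → Vec ℤ n → Vec ℤ n → Vec ℤ n
u +ᵥ v = zipWith ℤ._+_ u v
u -ᵥ v = zipWith ℤ._-_ u v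

IsOrderIdeal : (P : SimplicialPoset) → (Carrier P → Bool) → Set
IsOrderIdeal P I = ∀ x y → T (le P y x) → T (I x) → T (I y)

Sub : (P : SimplicialPoset) → (Carrier P → Bool) → Set
Sub P I = Σ (Carrier P) (λ x → T (I x))

SubLe : (P : SimplicialPoset) (I : Carrier P → Bool) → Sub P I → Sub P I → Set
SubLe P I a b = T (le P (proj₁ a) (proj₁ b))

-- Δ_d(k) = {F ⊆ [d] : F ⊉ [k]} ordered by inclusion

prefix : (d k : ℕ) → Subset d
prefix d k = tabulate (λ i → if toℕ i <ᵇ k then inside else outside)

Delta : (d k : ℕ) → Set
Delta d k = Σ (Subset d) (λ F → T (not ⌊ prefix d k ⊆? F ⌋))

DeltaLe : (d k : ℕ) → Delta d k → Delta d k → Set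
DeltaLe d k a b = proj₁ a ⊆ proj₁ b

-- R is (isomorphic to) the gluing P ∪_I Q = (P ⊔ Q)/(σ ∼ f σ), described
-- via the canonical maps ιP : P → R, ιQ : Q → R.

record IsGluing (P Q : SimplicialPoset) (I : Carrier P → Bool) (J : Carrier Q → Bool)
                (f : OrderIso (SubLe P I) (SubLe Q J)) (R : SimplicialPoset) : Set where
  field
    ιP : Carrier P → Carrier R
    ιQ : Carrier Q → Carrier R
    cover : ∀ r → (∃ λ x → ιP x ≡ r) ⊎ (∃ λ y → ιQ y ≡ r)
    ιP-inj : ∀ x x' → ιP x ≡ ιP x' → x ≡ x'
    ιQ-inj : ∀ y y' → ιQ y ≡ ιQ y' → y ≡ y'
    glue : ∀ x y → (ιP x ≡ ιQ y) ⇔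
             (Σ (T (I x)) λ p → proj₁ (Inverse.to (proj₁ f) (x , p)) ≡ y)
    order : ∀ r r' → T (le R r r') ⇔
             ((∃ λ x → ∃ λ x' → ιP x ≡ r × ιP x' ≡ r' × T (le P x x'))
              ⊎ (∃ λ y → ∃ λ y' → ιQ y ≡ r × ιQ y' ≡ r' × T (le Q y y')))

module Submission where

open import Defs
open import Data.Bool using (Bool)
open import Data.Nat using (ℕ; _≤_)
open import Data.Vec using (Vec)
open import Relation.Binary.PropositionalEquality using (_≡_)

-- The h-vector is a fixed ℤ-linear function of the face numbers, so the
-- theorem reduces to two facts about face numbers and one computation:
--
--  * Gluing.  Sending P ⊔ Q to (P ∪_I Q) ⊔ I by x ↦ [x], and y ↦ f⁻¹(y) for
--    y ∈ J, y ↦ [y] otherwise, is a rank-preserving bijection, so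
--    f(P ∪_I Q) + f(I) = f(P) + f(Q).  Ranks are preserved because an
--    injective monotone map whose image is closed downwards is a
--    bijection on lower intervals, and rank σ is read off from the size
--    2^(rank σ) of [0̂, σ].
--  * The ideal.  I ≅ Δ_d(k) sends rank to cardinality, so f(I) = f(Δ_d(k)).
--  * The h-vector of Δ_d(k) is e₀ - e_k.  Writing h_j = Σ_F w(|F|, j) over
--    the faces F, the faces containing [k] contribute e_k for every k ≤ d
--    (Pascal's rule, induction on d); Δ_d(k) is all faces (those containing
--    [0]) minus those containing [k].
--
-- Linearity of h then gives h(P ∪_I Q) = h(P) + h(Q) - e₀ + e_k.

open import Data.Bool using (true; false; T; not; if_then_else_; _∧_)
open import Data.Bool.Properties using (T-irrelevant; T-∧)
open import Data.Nat using (zero; suc; _≡ᵇ_; _<ᵇ_; _∸_; _^_; s≤s; z≤n)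
open import Data.Empty using (⊥-elim)
open import Data.Fin using (Fin; zero; suc; toℕ)
open import Data.Fin.Subset using (Subset; inside; outside; _⊆_; ∣_∣)
open import Data.Fin.Subset.Properties using (_⊆?_; ⊆-trans)
open import Data.Product using (Σ; _×_; _,_; proj₁; proj₂)
open import Data.Sum using (_⊎_; inj₁; inj₂; [_,_]′)
open import Data.Unit using (tt)
open import Data.Vec using ([]; _∷_)
open import Function using (_∘_; id)
open import Function.Bundles using (_↔_; Inverse; Injection; Equivalence; mk↔ₛ′)
open import Function.Construct.Composition using (_↔-∘_)
open import Function.Construct.Symmetry using (↔-sym)
open import Function.Properties.Inverse using (↔⇒↣)
open import Relation.Binary.PropositionalEquality
  using (refl; sym; trans; cong; cong₂; subst; subst₂; module ≡-Reasoning)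
open import Relation.Nullary using (¬_; yes; no; does)
open import Relation.Nullary.Decidable using (⌊_⌋; isYes≗does; T?)

open Inverse using (to; from; strictlyInverseˡ; strictlyInverseʳ)

Σ-T-≡ : {A : Set} {p : A → Bool} {a b : Σ A (λ x → T (p x))} →
        proj₁ a ≡ proj₁ b → a ≡ b
Σ-T-≡ {a = x , u} {b = .x , v} refl = cong (x ,_) (T-irrelevant u v)

↔-injective : {A B : Set} (e : A ↔ B) {a a' : A} → to e a ≡ to e a' → a ≡ a'
↔-injective e = Injection.injective (↔⇒↣ e)

injective-surjective⇒↔ : {A B : Set} (g : A → B) →
  (∀ a a' → g a ≡ g a' → a ≡ a') → (∀ b → Σ A (λ a → g a ≡ b)) → A ↔ B
injective-surjective⇒↔ g inj pre =
  mk↔ₛ′ g (proj₁ ∘ pre) (proj₂ ∘ pre) (λ a → inj _ _ (proj₂ (pre (g a))))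

Level : {A : Set} → (A → ℕ) → ℕ → Set
Level {A} r i = Σ A (λ a → T (r a ≡ᵇ i))

Level-↔ : {A B : Set} {rA : A → ℕ} {rB : B → ℕ} (e : A ↔ B) →
  (∀ a → rB (to e a) ≡ rA a) → ∀ i → Level rA i ↔ Level rB i
Level-↔ {rA = rA} {rB} e compat i = mk↔ₛ′
  (λ (a , t) → to e a , subst (λ n → T (n ≡ᵇ i)) (sym (compat a)) t)
  (λ (b , t) → from e b , subst (λ n → T (n ≡ᵇ i)) (back b) t)
  (λ (b , _) → Σ-T-≡ (strictlyInverseˡ e b))
  (λ (a , _) → Σ-T-≡ (strictlyInverseʳ e a))
  where
  back : ∀ b → rB b ≡ rA (from e b)
  back b = trans (cong rB (sym (strictlyInverseˡ e b))) (compat (from e b))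

Level-⊎ : {A B : Set} (rA : A → ℕ) (rB : B → ℕ) (i : ℕ) →
  Level [ rA , rB ]′ i ↔ (Level rA i ⊎ Level rB i)
Level-⊎ rA rB i = mk↔ₛ′ split join
  (λ { (inj₁ _) → refl ; (inj₂ _) → refl })
  (λ { (inj₁ _ , _) → refl ; (inj₂ _ , _) → refl })
  where
  split : Level [ rA , rB ]′ i → Level rA i ⊎ Level rB i
  split (inj₁ a , t) = inj₁ (a , t)
  split (inj₂ b , t) = inj₂ (b , t)
  join : Level rA i ⊎ Level rB i → Level [ rA , rB ]′ i
  join (inj₁ (a , t)) = inj₁ a , t
  join (inj₂ (b , t)) = inj₂ b , t

Level-Σ : {A : Set} (p : A → Bool) (r : A → ℕ) (i : ℕ) →
  Level {Σ A (λ a → T (p a))} (r ∘ proj₁) i ↔ Σ A (λ a → T (p a ∧ (r a ≡ᵇ i)))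
Level-Σ p r i = mk↔ₛ′
  (λ ((a , s) , t) → a , Equivalence.from T-∧ (s , t))
  (λ (a , u) → (a , proj₁ (Equivalence.to T-∧ u)) , proj₂ (Equivalence.to T-∧ u))
  (λ _ → Σ-T-≡ refl)
  (λ _ → Σ-T-≡ (Σ-T-≡ refl))

module Counting where
  open import Data.Nat using (_+_)
  open import Data.Nat.Properties using (+-identityʳ; <-cmp; <-irrefl; ^-monoʳ-<)
  open import Data.Fin.Properties using (+↔⊎)
  open import Data.List using (List; map; foldr; tabulate)
  open import Data.Sum.Function.Propositional using (_⊎-↔_)
  open import Relation.Binary using (tri<; tri≈; tri>)

  indicator-↔ : (b : Bool) → Fin (if b then 1 else 0) ↔ T b
  indicator-↔ true  = mk↔ₛ′ (λ _ → tt) (λ _ → zero) (λ _ → refl) (λ { zero → refl })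
  indicator-↔ false = mk↔ₛ′ (λ ()) (λ ()) (λ ()) (λ ())

  Σ-Fin-suc : {n : ℕ} (P : Fin (suc n) → Set) →
    Σ (Fin (suc n)) P ↔ (P zero ⊎ Σ (Fin n) (P ∘ suc))
  Σ-Fin-suc P = mk↔ₛ′ split join
    (λ { (inj₁ _) → refl ; (inj₂ _) → refl })
    (λ { (zero , _) → refl ; (suc _ , _) → refl })
    where
    split : Σ (Fin _) P → P zero ⊎ Σ (Fin _) (P ∘ suc)
    split (zero , x)  = inj₁ x
    split (suc j , x) = inj₂ (j , x)
    join : P zero ⊎ Σ (Fin _) (P ∘ suc) → Σ (Fin _) P
    join (inj₁ x)       = zero , x
    join (inj₂ (j , x)) = suc j , x

  countList : {B : Set} → (B → Bool) → List B → ℕ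
  countList p xs = foldr _+_ 0 (map (λ b → if p b then 1 else 0) xs)

  countList-tabulate : {B : Set} {n : ℕ} (p : B → Bool) (h : Fin n → B) →
    Fin (countList p (tabulate h)) ↔ Σ (Fin n) (λ j → T (p (h j)))
  countList-tabulate {n = zero} p h =
    mk↔ₛ′ (λ ()) (λ { (() , _) }) (λ { (() , _) }) (λ ())
  countList-tabulate {n = suc n} p h =
    ↔-sym (Σ-Fin-suc _) ↔-∘ ((indicator-↔ (p (h zero)) ⊎-↔ countList-tabulate p (h ∘ suc)) ↔-∘ +↔⊎)

  fRank-↔ : (X : SimplicialPoset) (i : ℕ) → Fin (fRank X i) ↔ Level (rank X) i
  fRank-↔ X i = Level-↔ {rB = rank X} (enum X) (λ _ → refl) i
    ↔-∘ countList-tabulate (λ j → rank X (to (enum X) j) ≡ᵇ i) id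

  countS : (d : ℕ) → (Subset d → Bool) → ℕ
  countS zero    p = if p [] then 1 else 0
  countS (suc d) p = countS d (p ∘ (outside ∷_)) + countS d (p ∘ (inside ∷_))

  Σ-Subset-suc : {d : ℕ} (P : Subset (suc d) → Set) →
    Σ (Subset (suc d)) P ↔ (Σ (Subset d) (P ∘ (outside ∷_)) ⊎ Σ (Subset d) (P ∘ (inside ∷_)))
  Σ-Subset-suc P = mk↔ₛ′ split join
    (λ { (inj₁ _) → refl ; (inj₂ _) → refl })
    (λ { ((false ∷ _) , _) → refl ; ((true ∷ _) , _) → refl })
    where
    split : Σ (Subset _) P → Σ (Subset _) (P ∘ (outside ∷_)) ⊎ Σ (Subset _) (P ∘ (inside ∷_))
    split ((false ∷ F) , x) = inj₁ (F , x)
    split ((true ∷ F) , x)  = inj₂ (F , x)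
    join : Σ (Subset _) (P ∘ (outside ∷_)) ⊎ Σ (Subset _) (P ∘ (inside ∷_)) → Σ (Subset _) P
    join (inj₁ (F , x)) = (outside ∷ F) , x
    join (inj₂ (F , x)) = (inside ∷ F) , x

  countS-↔ : (d : ℕ) (p : Subset d → Bool) → Fin (countS d p) ↔ Σ (Subset d) (λ F → T (p F))
  countS-↔ zero p = mk↔ₛ′ ([] ,_) (λ { ([] , x) → x }) (λ { ([] , _) → refl }) (λ _ → refl)
                    ↔-∘ indicator-↔ (p [])
  countS-↔ (suc d) p =
    ↔-sym (Σ-Subset-suc _) ↔-∘ ((countS-↔ d _ ⊎-↔ countS-↔ d _) ↔-∘ +↔⊎)

  countS-all : (d : ℕ) → countS d (λ _ → true) ≡ 2 ^ d
  countS-all zero    = refl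
  countS-all (suc d) = cong₂ _+_ (countS-all d) (trans (countS-all d) (sym (+-identityʳ _)))

  Subset-↔ : (n : ℕ) → Subset n ↔ Fin (2 ^ n)
  Subset-↔ n = subst (λ c → Subset n ↔ Fin c) (countS-all n)
    (↔-sym (countS-↔ n (λ _ → true)) ↔-∘ mk↔ₛ′ (_, tt) proj₁ (λ _ → refl) (λ _ → refl))

  _⊑_ : {d : ℕ} → Subset d → Subset d → Bool
  G ⊑ F = does (G ⊆? F)

  ⊑-sound : {d : ℕ} {G F : Subset d} → T (G ⊑ F) → G ⊆ F
  ⊑-sound {G = G} {F} t with G ⊆? F
  ... | yes G⊆F = G⊆F
  ... | no _    = ⊥-elim t

  ⊑-complete : {d : ℕ} {G F : Subset d} → G ⊆ F → T (G ⊑ F)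
  ⊑-complete {G = G} {F} G⊆F with G ⊆? F
  ... | yes _   = tt
  ... | no G⊈F = G⊈F G⊆F

  countS-none : (d : ℕ) → countS d (λ _ → false) ≡ 0
  countS-none zero    = refl
  countS-none (suc d) = cong₂ _+_ (countS-none d) (countS-none d)

  countS-⊑ : {d : ℕ} (F : Subset d) → countS d (_⊑ F) ≡ 2 ^ ∣ F ∣
  countS-⊑ []                  = refl
  countS-⊑ {suc d} (false ∷ F) = trans (cong₂ _+_ (countS-⊑ F) (countS-none d)) (+-identityʳ _)
  countS-⊑ (true ∷ F)          = cong₂ _+_ (countS-⊑ F) (trans (countS-⊑ F) (sym (+-identityʳ _)))

  2^-injective : (a b : ℕ) → 2 ^ a ≡ 2 ^ b → a ≡ b
  2^-injective a b eq with <-cmp a b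
  ... | tri< a<b _ _ = ⊥-elim (<-irrefl eq (^-monoʳ-< 2 (s≤s (s≤s z≤n)) a<b))
  ... | tri≈ _ a≡b _ = a≡b
  ... | tri> _ _ b<a = ⊥-elim (<-irrefl (sym eq) (^-monoʳ-< 2 (s≤s (s≤s z≤n)) b<a))

module Ranks where
  open Counting using (Subset-↔; 2^-injective)
  open import Data.Fin.Permutation using (↔⇒≡)

  Below : (X : SimplicialPoset) → Carrier X → Set
  Below X x = Σ (Carrier X) (λ y → T (le X y x))

  -- [0̂, x] is a Boolean algebra of rank (rank x), so it has 2^(rank x) elements.
  rank-from-card : (X : SimplicialPoset) (x : Carrier X) {n : ℕ} →
    Below X x ↔ Fin (2 ^ n) → rank X x ≡ n
  rank-from-card X x {n} e = 2^-injective (rank X x) n (↔⇒≡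
    (e ↔-∘ (↔-sym (proj₁ (boolean X x)) ↔-∘ ↔-sym (Subset-↔ (rank X x)))))

  -- An injective monotone map whose image is closed downwards below ι x
  -- maps [0̂, x] bijectively onto [0̂, ι x], hence preserves the rank of x.
  rank-embedding : (X Y : SimplicialPoset) (ι : Carrier X → Carrier Y) →
    (∀ a b → ι a ≡ ι b → a ≡ b) →
    (∀ a b → T (le X a b) → T (le Y (ι a) (ι b))) →
    (x : Carrier X) →
    (∀ r → T (le Y r (ι x)) → Σ (Carrier X) (λ a → T (le X a x) × ι a ≡ r)) →
    rank Y (ι x) ≡ rank X x
  rank-embedding X Y ι inj mono x down =
    rank-from-card Y (ι x) (Subset-↔ (rank X x) ↔-∘ (proj₁ (boolean X x) ↔-∘ ↔-sym lower))
    where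
    lower : Below X x ↔ Below Y (ι x)
    lower = injective-surjective⇒↔
      (λ (a , a≤x) → ι a , mono a x a≤x)
      (λ a a' eq → Σ-T-≡ (inj _ _ (cong proj₁ eq)))
      (λ (r , r≤ιx) → let (a , a≤x , ιa≡r) = down r r≤ιx in (a , a≤x) , Σ-T-≡ ιa≡r)

-- The faces of P ∪_I Q: every face of P ⊔ Q is a face of P ∪_I Q, except
-- that each face of I appears twice (once in P, once in Q as its image).
module Gluing (P Q : SimplicialPoset) (I : Carrier P → Bool) (J : Carrier Q → Bool)
              (I-ideal : IsOrderIdeal P I) (J-ideal : IsOrderIdeal Q J)
              (f : OrderIso (SubLe P I) (SubLe Q J))
              (R : SimplicialPoset) (gluing : IsGluing P Q I J f R) where
  open IsGluing gluing
  open Ranks using (rank-embedding)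
  open import Data.Sum.Properties using (inj₁-injective; inj₂-injective)

  φ : Sub P I ↔ Sub Q J
  φ = proj₁ f

  φ-monotone : ∀ a b → T (le P (proj₁ a) (proj₁ b)) → T (le Q (proj₁ (to φ a)) (proj₁ (to φ b)))
  φ-monotone a b = Equivalence.to (proj₂ f a b)

  φ-reflects : ∀ a b → T (le Q (proj₁ (to φ a)) (proj₁ (to φ b))) → T (le P (proj₁ a) (proj₁ b))
  φ-reflects a b = Equivalence.from (proj₂ f a b)

  glue-I : ∀ x (p : T (I x)) → ιP x ≡ ιQ (proj₁ (to φ (x , p)))
  glue-I x p = Equivalence.from (glue x _) (p , refl)

  glue-J : ∀ y (q : T (J y)) → ιP (proj₁ (from φ (y , q))) ≡ ιQ y
  glue-J y q = Equivalence.from (glue _ y) (proj₂ (from φ (y , q)) , cong proj₁ (strictlyInverseˡ φ (y , q)))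

  glued-in-J : ∀ x y → ιP x ≡ ιQ y → T (J y)
  glued-in-J x y e with Equivalence.to (glue x y) e
  ... | p , fx≡y = subst (λ z → T (J z)) fx≡y (proj₂ (to φ (x , p)))

  ιP-monotone : ∀ a b → T (le P a b) → T (le R (ιP a) (ιP b))
  ιP-monotone a b a≤b = Equivalence.from (order _ _) (inj₁ (a , b , refl , refl , a≤b))

  ιQ-monotone : ∀ a b → T (le Q a b) → T (le R (ιQ a) (ιQ b))
  ιQ-monotone a b a≤b = Equivalence.from (order _ _) (inj₂ (a , b , refl , refl , a≤b))

  -- Below ιP x, every face comes from a face of P below x: a face coming
  -- from Q lies below f(x), so it lies in J and comes from P via f⁻¹.
  ιP-down : ∀ x r → T (le R r (ιP x)) → Σ (Carrier P) (λ a → T (le P a x) × ιP a ≡ r)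
  ιP-down x r r≤ιx with Equivalence.to (order r (ιP x)) r≤ιx
  ... | inj₁ (a , x' , ιa≡r , ιx'≡ιx , a≤x') =
        a , subst (λ z → T (le P a z)) (ιP-inj _ _ ιx'≡ιx) a≤x' , ιa≡r
  ... | inj₂ (b , y , ιb≡r , ιy≡ιx , b≤y) with Equivalence.to (glue x y) (sym ιy≡ιx)
  ...   | p , fx≡y = proj₁ a , a≤x , trans (glue-J b b∈J) ιb≡r
    where
    b∈J : T (J b)
    b∈J = J-ideal y b b≤y (subst (λ z → T (J z)) fx≡y (proj₂ (to φ (x , p))))
    a : Sub P I
    a = from φ (b , b∈J)
    a≤x : T (le P (proj₁ a) x)
    a≤x = φ-reflects a (x , p)
      (subst₂ (λ u v → T (le Q u v)) (sym (cong proj₁ (strictlyInverseˡ φ (b , b∈J)))) (sym fx≡y) b≤y)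

  ιQ-down : ∀ y r → T (le R r (ιQ y)) → Σ (Carrier Q) (λ b → T (le Q b y) × ιQ b ≡ r)
  ιQ-down y r r≤ιy with Equivalence.to (order r (ιQ y)) r≤ιy
  ... | inj₂ (b , y' , ιb≡r , ιy'≡ιy , b≤y') =
        b , subst (λ z → T (le Q b z)) (ιQ-inj _ _ ιy'≡ιy) b≤y' , ιb≡r
  ... | inj₁ (a , x , ιa≡r , ιx≡ιy , a≤x) with Equivalence.to (glue x y) ιx≡ιy
  ...   | p , fx≡y = proj₁ (to φ (a , a∈I)) , b≤y , trans (sym (glue-I a a∈I)) ιa≡r
    where
    a∈I : T (I a)
    a∈I = I-ideal x a a≤x p
    b≤y : T (le Q (proj₁ (to φ (a , a∈I))) y)
    b≤y = subst (λ z → T (le Q (proj₁ (to φ (a , a∈I))) z)) fx≡y (φ-monotone (a , a∈I) (x , p) a≤x)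

  rank-ιP : ∀ x → rank R (ιP x) ≡ rank P x
  rank-ιP x = rank-embedding P R ιP ιP-inj ιP-monotone x (ιP-down x)

  rank-ιQ : ∀ y → rank R (ιQ y) ≡ rank Q y
  rank-ιQ y = rank-embedding Q R ιQ ιQ-inj ιQ-monotone y (ιQ-down y)

  merge : Carrier P ⊎ Carrier Q → Carrier R ⊎ Sub P I
  merge (inj₁ x) = inj₁ (ιP x)
  merge (inj₂ y) with T? (J y)
  ... | yes q = inj₂ (from φ (y , q))
  ... | no _  = inj₁ (ιQ y)

  merge-J : ∀ y (q : T (J y)) → merge (inj₂ y) ≡ inj₂ (from φ (y , q))
  merge-J y q with T? (J y)
  ... | yes q' = cong (λ q → inj₂ (from φ (y , q))) (T-irrelevant q' q)
  ... | no y∉J = ⊥-elim (y∉J q)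

  merge-∉J : ∀ y → ¬ T (J y) → merge (inj₂ y) ≡ inj₁ (ιQ y)
  merge-∉J y y∉J with T? (J y)
  ... | yes q = ⊥-elim (y∉J q)
  ... | no _  = refl

  merge-injective : ∀ u v → merge u ≡ merge v → u ≡ v
  merge-injective (inj₁ x) (inj₁ x') e = cong inj₁ (ιP-inj x x' (inj₁-injective e))
  merge-injective (inj₁ x) (inj₂ y) e with T? (J y)
  ... | no y∉J = ⊥-elim (y∉J (glued-in-J x y (inj₁-injective e)))
  merge-injective (inj₂ y) (inj₁ x) e with T? (J y)
  ... | no y∉J = ⊥-elim (y∉J (glued-in-J x y (sym (inj₁-injective e))))
  merge-injective (inj₂ y) (inj₂ y') e with T? (J y) | T? (J y')
  ... | yes q | yes q' = cong (inj₂ ∘ proj₁) (↔-injective (↔-sym φ) (inj₂-injective e))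
  ... | no _  | no _   = cong inj₂ (ιQ-inj y y' (inj₁-injective e))

  merge-surjective : ∀ z → Σ (Carrier P ⊎ Carrier Q) (λ u → merge u ≡ z)
  merge-surjective (inj₂ (x , p)) =
    inj₂ (proj₁ (to φ (x , p))) ,
    trans (merge-J _ (proj₂ (to φ (x , p)))) (cong inj₂ (strictlyInverseʳ φ (x , p)))
  merge-surjective (inj₁ r) with cover r
  ... | inj₁ (x , ιx≡r) = inj₁ x , cong inj₁ ιx≡r
  ... | inj₂ (y , ιy≡r) with T? (J y)
  ...   | yes q  = inj₁ (proj₁ (from φ (y , q))) , cong inj₁ (trans (glue-J y q) ιy≡r)
  ...   | no y∉J = inj₂ y , trans (merge-∉J y y∉J) (cong inj₁ ιy≡r)

  merge-↔ : (Carrier P ⊎ Carrier Q) ↔ (Carrier R ⊎ Sub P I)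
  merge-↔ = injective-surjective⇒↔ merge merge-injective merge-surjective

  merge-rank : ∀ u → [ rank R , rank P ∘ proj₁ ]′ (merge u) ≡ [ rank P , rank Q ]′ u
  merge-rank (inj₁ x) = rank-ιP x
  merge-rank (inj₂ y) with T? (J y)
  ... | yes q = trans (sym (rank-ιP _)) (trans (cong (rank R) (glue-J y q)) (rank-ιQ y))
  ... | no _  = rank-ιQ y

  glued-levels : ∀ i → (Level (rank P) i ⊎ Level (rank Q) i) ↔
                       (Level (rank R) i ⊎ Level (rank P ∘ proj₁) i)
  glued-levels i =
    Level-⊎ (rank R) (rank P ∘ proj₁) i
      ↔-∘ (Level-↔ {rB = [ rank R , rank P ∘ proj₁ ]′} merge-↔ merge-rank i
             ↔-∘ ↔-sym (Level-⊎ (rank P) (rank Q) i))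

inΔ : (d k : ℕ) → Subset d → Bool
inΔ d k F = not ⌊ prefix d k ⊆? F ⌋

inΔ-lower : {d k : ℕ} {G F : Subset d} → G ⊆ F → T (inΔ d k F) → T (inΔ d k G)
inΔ-lower {d} {k} {G} {F} G⊆F F∈Δ with prefix d k ⊆? G
... | no _ = tt
... | yes [k]⊆G with prefix d k ⊆? F
...   | yes _     = F∈Δ
...   | no [k]⊈F = [k]⊈F (⊆-trans [k]⊆G G⊆F)

module IdealAsDelta (d k : ℕ) (P : SimplicialPoset) (I : Carrier P → Bool)
                    (I-ideal : IsOrderIdeal P I) (ψ : OrderIso (SubLe P I) (DeltaLe d k)) where
  open Counting using (_⊑_; ⊑-sound; ⊑-complete; countS-↔; countS-⊑)
  open Ranks using (Below; rank-from-card)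

  face : Sub P I → Subset d
  face a = proj₁ (to (proj₁ ψ) a)

  below-↔ : ∀ x (p : T (I x)) → Below P x ↔ Σ (Subset d) (λ G → T (G ⊑ face (x , p)))
  below-↔ x p = injective-surjective⇒↔ image
    (λ _ _ e → Σ-T-≡ (cong proj₁ (↔-injective (proj₁ ψ) (Σ-T-≡ (cong proj₁ e)))))
    preimage
    where
    image : Below P x → Σ (Subset d) (λ G → T (G ⊑ face (x , p)))
    image (a , a≤x) = face (a , I-ideal x a a≤x p) ,
                      ⊑-complete (Equivalence.to (proj₂ ψ _ (x , p)) a≤x)
    preimage : ∀ G → Σ (Below P x) (λ a → image a ≡ G)
    preimage (G , G⊑F) = (proj₁ b , b≤x) , Σ-T-≡ (trans (cong face (Σ-T-≡ refl)) (cong proj₁ ψb≡G))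
      where
      G∈Δ : T (inΔ d k G)
      G∈Δ = inΔ-lower {d} {k} (⊑-sound G⊑F) (proj₂ (to (proj₁ ψ) (x , p)))
      b : Sub P I
      b = from (proj₁ ψ) (G , G∈Δ)
      ψb≡G : to (proj₁ ψ) b ≡ (G , G∈Δ)
      ψb≡G = strictlyInverseˡ (proj₁ ψ) (G , G∈Δ)
      b≤x : T (le P (proj₁ b) x)
      b≤x = Equivalence.from (proj₂ ψ b (x , p))
              (subst (λ c → proj₁ c ⊆ face (x , p)) (sym ψb≡G) (⊑-sound G⊑F))

  -- Hence rank x = |ψ(x)|, since both intervals have 2^rank elements.
  rank-face : ∀ x (p : T (I x)) → rank P x ≡ ∣ face (x , p) ∣
  rank-face x p = rank-from-card P x
    (subst (λ c → Below P x ↔ Fin c) (countS-⊑ (face (x , p)))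
           (↔-sym (countS-↔ d _) ↔-∘ below-↔ x p))

  ideal-levels : ∀ i → Level (rank P ∘ proj₁) i ↔ Σ (Subset d) (λ F → T (inΔ d k F ∧ (∣ F ∣ ≡ᵇ i)))
  ideal-levels i = Level-Σ (inΔ d k) ∣_∣ i
    ↔-∘ Level-↔ {rB = ∣_∣ ∘ proj₁} (proj₁ ψ) (λ (x , p) → sym (rank-face x p)) i

fΔ : (d k : ℕ) → ℕ → ℕ
fΔ d k i = Counting.countS d (λ F → inΔ d k F ∧ (∣ F ∣ ≡ᵇ i))

module FaceNumbers (d k : ℕ) (P Q : SimplicialPoset) (I : Carrier P → Bool) (J : Carrier Q → Bool)
                   (I-ideal : IsOrderIdeal P I) (J-ideal : IsOrderIdeal Q J)
                   (f : OrderIso (SubLe P I) (SubLe Q J)) (ψ : OrderIso (SubLe P I) (DeltaLe d k))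
                   (R : SimplicialPoset) (gluing : IsGluing P Q I J f R) where
  open import Data.Nat using (_+_)
  open import Data.Fin.Permutation using (↔⇒≡)
  open import Data.Fin.Properties using (+↔⊎)
  open import Data.Sum.Function.Propositional using (_⊎-↔_)
  open import Function.Related.Propositional using (module EquationalReasoning)
  open Counting using (fRank-↔; countS-↔)
  open Gluing P Q I J I-ideal J-ideal f R gluing using (glued-levels)
  open IdealAsDelta d k P I I-ideal ψ using (ideal-levels)

  face-count : ∀ i → fRank R i + fΔ d k i ≡ fRank P i + fRank Q i
  face-count i = ↔⇒≡ (begin
      Fin (fRank R i + fΔ d k i)
    ↔⟨ +↔⊎ ⟩
      (Fin (fRank R i) ⊎ Fin (fΔ d k i))
    ↔⟨ fRank-↔ R i ⊎-↔ (↔-sym (ideal-levels i) ↔-∘ countS-↔ d _) ⟩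
      (Level (rank R) i ⊎ Level (rank P ∘ proj₁) i)
    ↔⟨ ↔-sym (glued-levels i) ⟩
      (Level (rank P) i ⊎ Level (rank Q) i)
    ↔⟨ ↔-sym (fRank-↔ P i ⊎-↔ fRank-↔ Q i) ⟩
      (Fin (fRank P i) ⊎ Fin (fRank Q i))
    ↔⟨ ↔-sym +↔⊎ ⟩
      Fin (fRank P i + fRank Q i) ∎)
    where open EquationalReasoning

module HVector where
  open import Data.Integer as ℤ using (ℤ; +_; _+_; _*_; _-_)
  open import Data.Integer.Properties
    using (pos-+; pos-*; *-assoc; *-identityˡ; *-zeroʳ; +-identityˡ; +-identityʳ; +-inverseʳ; *-distribˡ-+)
  open import Data.Integer.Tactic.RingSolver using (solve-∀)
  open import Data.Nat.Combinatorics using (_C_; nCk+nC[k+1]≡[n+1]C[k+1])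
  open import Data.Fin.Subset.Properties using (∣p∣≤n)
  open import Data.List using (List; []; _∷_; map; upTo; applyUpTo)
  open import Data.List.Properties using (map-cong; map-applyUpTo)
  open import Data.Vec using (tabulate; zipWith)
  open import Data.Vec.Properties using (tabulate-cong)
  import Data.Nat as Nat
  import Data.Nat.Properties as NatP
  open Counting using (countS; _⊑_)
  open ≡-Reasoning

  ind : Bool → ℤ
  ind b = if b then + 1 else + 0

  +-interchange : ∀ a b c e → (a + b) + (c + e) ≡ (a + c) + (b + e)
  +-interchange = solve-∀

  ΣS : (d : ℕ) → (Subset d → ℤ) → ℤ
  ΣS zero    g = g []
  ΣS (suc d) g = ΣS d (g ∘ (outside ∷_)) + ΣS d (g ∘ (inside ∷_))

  ΣS-cong : (d : ℕ) {g h : Subset d → ℤ} → (∀ F → g F ≡ h F) → ΣS d g ≡ ΣS d h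
  ΣS-cong zero    eq = eq []
  ΣS-cong (suc d) eq = cong₂ _+_ (ΣS-cong d (eq ∘ (outside ∷_))) (ΣS-cong d (eq ∘ (inside ∷_)))

  ΣS-zero : (d : ℕ) → ΣS d (λ _ → + 0) ≡ + 0
  ΣS-zero zero    = refl
  ΣS-zero (suc d) = cong₂ _+_ (ΣS-zero d) (ΣS-zero d)

  ΣS-+ : (d : ℕ) (g h : Subset d → ℤ) → ΣS d (λ F → g F + h F) ≡ ΣS d g + ΣS d h
  ΣS-+ zero    g h = refl
  ΣS-+ (suc d) g h = trans (cong₂ _+_ (ΣS-+ d _ _) (ΣS-+ d _ _))
    (+-interchange (ΣS d (g ∘ (outside ∷_))) (ΣS d (h ∘ (outside ∷_)))
                   (ΣS d (g ∘ (inside ∷_))) (ΣS d (h ∘ (inside ∷_))))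

  ΣS-- : (d : ℕ) (g h : Subset d → ℤ) → ΣS d (λ F → g F - h F) ≡ ΣS d g - ΣS d h
  ΣS-- zero    g h = refl
  ΣS-- (suc d) g h = trans (cong₂ _+_ (ΣS-- d _ _) (ΣS-- d _ _))
    (-interchange (ΣS d (g ∘ (outside ∷_))) (ΣS d (h ∘ (outside ∷_)))
                  (ΣS d (g ∘ (inside ∷_))) (ΣS d (h ∘ (inside ∷_))))
    where
    -interchange : ∀ a b c e → (a - b) + (c - e) ≡ (a + c) - (b + e)
    -interchange = solve-∀

  ΣS-scale : (d : ℕ) (c : ℤ) (g : Subset d → ℤ) → ΣS d (λ F → c * g F) ≡ c * ΣS d g
  ΣS-scale zero    c g = refl
  ΣS-scale (suc d) c g = trans (cong₂ _+_ (ΣS-scale d c _) (ΣS-scale d c _)) (sym (*-distribˡ-+ c _ _))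

  countS-ΣS : (d : ℕ) (p : Subset d → Bool) → + countS d p ≡ ΣS d (ind ∘ p)
  countS-ΣS zero p with p []
  ... | true  = refl
  ... | false = refl
  countS-ΣS (suc d) p =
    trans (pos-+ (countS d (p ∘ (outside ∷_))) (countS d (p ∘ (inside ∷_))))
          (cong₂ _+_ (countS-ΣS d _) (countS-ΣS d _))

  -- h_j in terms of the face numbers f (f i = number of faces of rank i):
  -- hEntry d X j is hFrom d (fRank X) j.
  hFrom : ℕ → (ℕ → ℕ) → ℕ → ℤ
  hFrom d f j = sumℤ (map (λ i → sgn (j ∸ i) * (+ (((d ∸ i) C (j ∸ i)) Nat.* f i))) (upTo (suc j)))

  hFrom-cong : (d : ℕ) {f g : ℕ → ℕ} → (∀ i → f i ≡ g i) → ∀ j → hFrom d f j ≡ hFrom d g j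
  hFrom-cong d eq j = cong sumℤ (map-cong
    (λ i → cong (λ n → sgn (j ∸ i) * + (((d ∸ i) C (j ∸ i)) Nat.* n)) (eq i)) (upTo (suc j)))

  sumℤ-map-+ : (L : List ℕ) (a b : ℕ → ℤ) →
    sumℤ (map (λ i → a i + b i) L) ≡ sumℤ (map a L) + sumℤ (map b L)
  sumℤ-map-+ []      a b = refl
  sumℤ-map-+ (i ∷ L) a b = trans (cong (λ s → a i + b i + s) (sumℤ-map-+ L a b))
    (+-interchange (a i) (b i) (sumℤ (map a L)) (sumℤ (map b L)))

  hFrom-+ : (d : ℕ) (f g : ℕ → ℕ) (j : ℕ) → hFrom d (λ i → f i Nat.+ g i) j ≡ hFrom d f j + hFrom d g j
  hFrom-+ d f g j = trans (cong sumℤ (map-cong term (upTo (suc j)))) (sumℤ-map-+ (upTo (suc j)) (t f) (t g))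
    where
    t : (ℕ → ℕ) → ℕ → ℤ
    t h i = sgn (j ∸ i) * + (((d ∸ i) C (j ∸ i)) Nat.* h i)
    term : ∀ i → sgn (j ∸ i) * + (((d ∸ i) C (j ∸ i)) Nat.* (f i Nat.+ g i)) ≡ t f i + t g i
    term i = begin
        sgn (j ∸ i) * + (c Nat.* (f i Nat.+ g i))
      ≡⟨ cong (λ n → sgn (j ∸ i) * + n) (NatP.*-distribˡ-+ c (f i) (g i)) ⟩
        sgn (j ∸ i) * + (c Nat.* f i Nat.+ c Nat.* g i)
      ≡⟨ cong (sgn (j ∸ i) *_) (pos-+ (c Nat.* f i) (c Nat.* g i)) ⟩
        sgn (j ∸ i) * (+ (c Nat.* f i) + + (c Nat.* g i))
      ≡⟨ *-distribˡ-+ (sgn (j ∸ i)) _ _ ⟩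
        t f i + t g i ∎
      where c = (d ∸ i) C (j ∸ i)

  coef : ℕ → ℕ → ℕ → ℤ
  coef d j i = sgn (j ∸ i) * + ((d ∸ i) C (j ∸ i))

  -- The contribution to h_j of a single face with s vertices.
  weight : ℕ → ℕ → ℕ → ℤ
  weight d s j = if s <ᵇ suc j then coef d j s else + 0

  sumℤ-zeros : (h : ℕ → ℤ) (n : ℕ) → (∀ i → h i ≡ + 0) → sumℤ (applyUpTo h n) ≡ + 0
  sumℤ-zeros h zero    _     = refl
  sumℤ-zeros h (suc n) zeros = cong₂ _+_ (zeros 0) (sumℤ-zeros (h ∘ suc) n (zeros ∘ suc))

  select : (c : ℕ → ℤ) (s n : ℕ) →
    sumℤ (applyUpTo (λ i → ind (s ≡ᵇ i) * c i) n) ≡ (if s <ᵇ n then c s else + 0)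
  select c s       zero    = refl
  select c zero    (suc n) = trans (cong₂ _+_ (*-identityˡ (c 0)) (sumℤ-zeros _ n (λ _ → refl)))
                                   (+-identityʳ (c 0))
  select c (suc s) (suc n) = trans (+-identityˡ _) (select (c ∘ suc) s n)

  weight-as-sum : (d s j : ℕ) → weight d s j ≡ sumℤ (map (λ i → ind (s ≡ᵇ i) * coef d j i) (upTo (suc j)))
  weight-as-sum d s j =
    sym (trans (cong sumℤ (map-applyUpTo id (λ i → ind (s ≡ᵇ i) * coef d j i) (suc j)))
               (select (coef d j) s (suc j)))

  sum-ΣS-interchange : (d : ℕ) (L : List ℕ) (a : Subset d → ℤ) (b : ℕ → Subset d → ℤ) →
    sumℤ (map (λ i → ΣS d (λ F → a F * b i F)) L) ≡ ΣS d (λ F → a F * sumℤ (map (λ i → b i F) L))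
  sum-ΣS-interchange d []      a b = sym (trans (ΣS-cong d (λ F → *-zeroʳ (a F))) (ΣS-zero d))
  sum-ΣS-interchange d (i ∷ L) a b =
    trans (cong (λ s → ΣS d (λ F → a F * b i F) + s) (sum-ΣS-interchange d L a b))
          (trans (sym (ΣS-+ d _ _)) (ΣS-cong d (λ F → sym (*-distribˡ-+ (a F) _ _))))

  scaled-ind-∧ : ∀ c a b → c * ind (a ∧ b) ≡ ind a * (ind b * c)
  scaled-ind-∧ c true  b = lemma c (ind b)
    where
    lemma : ∀ c x → c * x ≡ + 1 * (x * c)
    lemma = solve-∀
  scaled-ind-∧ c false b = *-zeroʳ c

  hFrom-count : (d : ℕ) (q : Subset d → Bool) (j : ℕ) →
    hFrom d (λ i → countS d (λ F → q F ∧ (∣ F ∣ ≡ᵇ i))) j ≡ ΣS d (λ F → ind (q F) * weight d ∣ F ∣ j)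
  hFrom-count d q j = begin
      hFrom d (λ i → countS d (λ F → q F ∧ (∣ F ∣ ≡ᵇ i))) j
    ≡⟨ cong sumℤ (map-cong term (upTo (suc j))) ⟩
      sumℤ (map (λ i → ΣS d (λ F → ind (q F) * (ind (∣ F ∣ ≡ᵇ i) * coef d j i))) (upTo (suc j)))
    ≡⟨ sum-ΣS-interchange d (upTo (suc j)) (ind ∘ q) (λ i F → ind (∣ F ∣ ≡ᵇ i) * coef d j i) ⟩
      ΣS d (λ F → ind (q F) * sumℤ (map (λ i → ind (∣ F ∣ ≡ᵇ i) * coef d j i) (upTo (suc j))))
    ≡⟨ ΣS-cong d (λ F → cong (ind (q F) *_) (sym (weight-as-sum d ∣ F ∣ j))) ⟩
      ΣS d (λ F → ind (q F) * weight d ∣ F ∣ j) ∎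
    where
    term : ∀ i → sgn (j ∸ i) * + (((d ∸ i) C (j ∸ i)) Nat.* countS d (λ F → q F ∧ (∣ F ∣ ≡ᵇ i)))
               ≡ ΣS d (λ F → ind (q F) * (ind (∣ F ∣ ≡ᵇ i) * coef d j i))
    term i = begin
        sgn (j ∸ i) * + (c Nat.* n)
      ≡⟨ cong (sgn (j ∸ i) *_) (pos-* c n) ⟩
        sgn (j ∸ i) * (+ c * + n)
      ≡⟨ *-assoc (sgn (j ∸ i)) (+ c) (+ n) ⟨
        coef d j i * + n
      ≡⟨ cong (coef d j i *_) (countS-ΣS d _) ⟩
        coef d j i * ΣS d (λ F → ind (q F ∧ (∣ F ∣ ≡ᵇ i)))
      ≡⟨ ΣS-scale d (coef d j i) _ ⟨
        ΣS d (λ F → coef d j i * ind (q F ∧ (∣ F ∣ ≡ᵇ i)))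
      ≡⟨ ΣS-cong d (λ F → scaled-ind-∧ (coef d j i) (q F) (∣ F ∣ ≡ᵇ i)) ⟩
        ΣS d (λ F → ind (q F) * (ind (∣ F ∣ ≡ᵇ i) * coef d j i)) ∎
      where
      c n : ℕ
      c = (d ∸ i) C (j ∸ i)
      n = countS d (λ F → q F ∧ (∣ F ∣ ≡ᵇ i))

  -- Pascal's rule for weights: a face F ⊆ [d] and F ∪ {d+1} together
  -- contribute to h_j over [d+1] what F alone contributes over [d].
  weight-pascal : (d s j : ℕ) → s ≤ d → weight (suc d) s j + weight (suc d) (suc s) j ≡ weight d s j
  weight-pascal d zero zero _ = +-identityʳ _
  weight-pascal d zero (suc j) _ = begin
      sgn (suc j) * + (suc d C suc j) + sgn j * + (d C j)
    ≡⟨ cong (λ n → sgn (suc j) * + n + sgn j * + (d C j)) (nCk+nC[k+1]≡[n+1]C[k+1] d j) ⟨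
      sgn (suc j) * + (d C j Nat.+ d C suc j) + sgn j * + (d C j)
    ≡⟨ cong (λ z → sgn (suc j) * z + sgn j * + (d C j)) (pos-+ (d C j) (d C suc j)) ⟩
      ℤ.- sgn j * (+ (d C j) + + (d C suc j)) + sgn j * + (d C j)
    ≡⟨ cancel (sgn j) (+ (d C j)) (+ (d C suc j)) ⟩
      sgn (suc j) * + (d C suc j) ∎
    where
    cancel : ∀ x a b → ℤ.- x * (a + b) + x * a ≡ ℤ.- x * b
    cancel = solve-∀
  weight-pascal d (suc s) zero _ = refl
  weight-pascal (suc d) (suc s) (suc j) (s≤s s≤d) = weight-pascal d s j s≤d

  prefix-0-⊑ : (d : ℕ) (F : Subset d) → prefix d 0 ⊑ F ≡ true
  prefix-0-⊑ zero    []      = refl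
  prefix-0-⊑ (suc d) (_ ∷ F) = prefix-0-⊑ d F

  weight-sum-above : (d k : ℕ) → k ≤ d → ∀ j →
    ΣS d (λ F → ind (prefix d k ⊑ F) * weight d ∣ F ∣ j) ≡ ind (j ≡ᵇ k)
  weight-sum-above zero zero _ zero    = refl
  weight-sum-above zero zero _ (suc j) = cong (+ 1 *_) (*-zeroʳ (sgn (suc j)))
  weight-sum-above (suc d) zero _ j = begin
      ΣS d (λ F → above F * weight (suc d) ∣ F ∣ j) + ΣS d (λ F → above F * weight (suc d) (suc ∣ F ∣) j)
    ≡⟨ ΣS-+ d _ _ ⟨
      ΣS d (λ F → above F * weight (suc d) ∣ F ∣ j + above F * weight (suc d) (suc ∣ F ∣) j)
    ≡⟨ ΣS-cong d (λ F → trans (sym (*-distribˡ-+ (above F) _ _))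
                              (cong (above F *_) (weight-pascal d ∣ F ∣ j (∣p∣≤n F)))) ⟩
      ΣS d (λ F → above F * weight d ∣ F ∣ j)
    ≡⟨ weight-sum-above d zero z≤n j ⟩
      ind (j ≡ᵇ 0) ∎
    where
    above : Subset d → ℤ
    above F = ind (prefix d 0 ⊑ F)
  weight-sum-above (suc d) (suc k) (s≤s _) zero =
    cong₂ _+_ (ΣS-zero d) (trans (ΣS-cong d (λ F → *-zeroʳ (ind (prefix d k ⊑ F)))) (ΣS-zero d))
  weight-sum-above (suc d) (suc k) (s≤s k≤d) (suc j) =
    trans (cong (_+ ΣS d (λ F → ind (prefix d k ⊑ F) * weight d ∣ F ∣ j)) (ΣS-zero d))
          (trans (+-identityˡ _) (weight-sum-above d k k≤d j))

  ind-not : ∀ b x → ind (not b) * x ≡ ind true * x - ind b * x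
  ind-not true  x = sym (+-inverseʳ (+ 1 * x))
  ind-not false x = sym (+-identityʳ (+ 1 * x))

  -- h(Δ_d(k)) = e₀ - e_k: the subsets of [d] are those containing [0], and
  -- Δ_d(k) consists of those not containing [k].
  h-of-Δ : (d k : ℕ) → k ≤ d → ∀ j → hFrom d (fΔ d k) j ≡ ind (j ≡ᵇ 0) - ind (j ≡ᵇ k)
  h-of-Δ d k k≤d j = begin
      hFrom d (fΔ d k) j
    ≡⟨ hFrom-count d (inΔ d k) j ⟩
      ΣS d (λ F → ind (inΔ d k F) * w F)
    ≡⟨ ΣS-cong d complement ⟩
      ΣS d (λ F → ind (prefix d 0 ⊑ F) * w F - ind (prefix d k ⊑ F) * w F)
    ≡⟨ ΣS-- d _ _ ⟩
      ΣS d (λ F → ind (prefix d 0 ⊑ F) * w F) - ΣS d (λ F → ind (prefix d k ⊑ F) * w F)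
    ≡⟨ cong₂ _-_ (weight-sum-above d 0 z≤n j) (weight-sum-above d k k≤d j) ⟩
      ind (j ≡ᵇ 0) - ind (j ≡ᵇ k) ∎
    where
    w : Subset d → ℤ
    w F = weight d ∣ F ∣ j
    complement : ∀ F → ind (inΔ d k F) * w F ≡ ind (prefix d 0 ⊑ F) * w F - ind (prefix d k ⊑ F) * w F
    complement F = begin
        ind (not ⌊ prefix d k ⊆? F ⌋) * w F
      ≡⟨ cong (λ b → ind (not b) * w F) (isYes≗does (prefix d k ⊆? F)) ⟩
        ind (not (prefix d k ⊑ F)) * w F
      ≡⟨ ind-not (prefix d k ⊑ F) (w F) ⟩
        ind true * w F - ind (prefix d k ⊑ F) * w F
      ≡⟨ cong (λ b → ind b * w F - ind (prefix d k ⊑ F) * w F) (prefix-0-⊑ d F) ⟨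
        ind (prefix d 0 ⊑ F) * w F - ind (prefix d k ⊑ F) * w F ∎

  h-glued : (d k : ℕ) → k ≤ d → (fR fP fQ : ℕ → ℕ) →
    (∀ i → fR i Nat.+ fΔ d k i ≡ fP i Nat.+ fQ i) →
    ∀ j → hFrom d fR j ≡ hFrom d fP j + hFrom d fQ j - ind (j ≡ᵇ 0) + ind (j ≡ᵇ k)
  h-glued d k k≤d fR fP fQ faces j = begin
      hFrom d fR j
    ≡⟨ add-sub (hFrom d fR j) (hFrom d (fΔ d k) j) ⟩
      hFrom d fR j + hFrom d (fΔ d k) j - hFrom d (fΔ d k) j
    ≡⟨ cong (_- hFrom d (fΔ d k) j) (hFrom-+ d fR (fΔ d k) j) ⟨
      hFrom d (λ i → fR i Nat.+ fΔ d k i) j - hFrom d (fΔ d k) j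
    ≡⟨ cong₂ _-_ (trans (hFrom-cong d faces j) (hFrom-+ d fP fQ j)) (h-of-Δ d k k≤d j) ⟩
      hFrom d fP j + hFrom d fQ j - (ind (j ≡ᵇ 0) - ind (j ≡ᵇ k))
    ≡⟨ sub-sub (hFrom d fP j + hFrom d fQ j) (ind (j ≡ᵇ 0)) (ind (j ≡ᵇ k)) ⟩
      hFrom d fP j + hFrom d fQ j - ind (j ≡ᵇ 0) + ind (j ≡ᵇ k) ∎
    where
    add-sub : ∀ x y → x ≡ x + y - y
    add-sub = solve-∀
    sub-sub : ∀ x a b → x - (a - b) ≡ x - a + b
    sub-sub = solve-∀

  zipWith-tabulate : {n : ℕ} (g : ℤ → ℤ → ℤ) (a b : Fin n → ℤ) →
    zipWith g (tabulate a) (tabulate b) ≡ tabulate (λ j → g (a j) (b j))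
  zipWith-tabulate {zero}  g a b = refl
  zipWith-tabulate {suc n} g a b = cong (g (a zero) (b zero) ∷_) (zipWith-tabulate g (a ∘ suc) (b ∘ suc))

  tabulate-entries : {n : ℕ} (r p q u v : Fin n → ℤ) → (∀ j → r j ≡ p j + q j - u j + v j) →
    tabulate r ≡ tabulate p +ᵥ tabulate q -ᵥ tabulate u +ᵥ tabulate v
  tabulate-entries r p q u v entries = begin
      tabulate r
    ≡⟨ tabulate-cong entries ⟩
      tabulate (λ j → p j + q j - u j + v j)
    ≡⟨ zipWith-tabulate _+_ (λ j → p j + q j - u j) v ⟨
      tabulate (λ j → p j + q j - u j) +ᵥ tabulate v
    ≡⟨ cong (_+ᵥ tabulate v) (zipWith-tabulate _-_ (λ j → p j + q j) u) ⟨
      tabulate (λ j → p j + q j) -ᵥ tabulate u +ᵥ tabulate v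
    ≡⟨ cong (λ s → s -ᵥ tabulate u +ᵥ tabulate v) (zipWith-tabulate _+_ p q) ⟨
      tabulate p +ᵥ tabulate q -ᵥ tabulate u +ᵥ tabulate v ∎

-- Lemma 3.2.
lemma3p2 : (d k : ℕ) → 1 ≤ k → k ≤ d →
  (P Q : SimplicialPoset) → IsDim P d → IsDim Q d →
  (I : Carrier P → Bool) (J : Carrier Q → Bool) →
  IsOrderIdeal P I → IsOrderIdeal Q J →
  (f : OrderIso (SubLe P I) (SubLe Q J)) →
  OrderIso (SubLe P I) (DeltaLe d k) →
  (R : SimplicialPoset) → IsGluing P Q I J f R →
  hVec d R ≡ hVec d P +ᵥ hVec d Q -ᵥ unitVec d 0 +ᵥ unitVec d k
lemma3p2 d k _ k≤d P Q _ _ I J I-ideal J-ideal f ψ R gluing =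
  tabulate-entries (hEntry d R ∘ toℕ) (hEntry d P ∘ toℕ) (hEntry d Q ∘ toℕ)
                   (λ j → ind (toℕ j ≡ᵇ 0)) (λ j → ind (toℕ j ≡ᵇ k))
                   (λ j → h-glued d k k≤d (fRank R) (fRank P) (fRank Q) face-count (toℕ j))
  where
  open HVector using (ind; h-glued; tabulate-entries)
  open FaceNumbers d k P Q I J I-ideal J-ideal f ψ R gluing using (face-count)
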